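{- Let $1\le i<j\le n$, $y\in p\mathbb{Z}_p$ and $A=(a_{k,l})\in U$. Then there is a unique decomposition $(1-yE_{i,j})A=XZ$ with $X=(x_{k,l})\in U$ and $Z=(z_{r,s})\in Q_0$. Moreover: (1) every diagonal entry is of the form $z_{r,r}=\frac{1-y\,h_{r,r}(y,a)}{1-y\,g_{r,r}(y,a)}$; (2) every entry with $r<s$ is of the form $z_{r,s}=\frac{y\,h_{r,s}(y,a)}{1-y\,g_{r,s}(y,a)}$; (3) every entry with $k>l$ is of the form $x_{k,l}=\frac{h_{k,l}(y,a)}{1-y\,g_{k,l}(y,a)}$; where the $h_{\star,\star}$ and $g_{\star,\star}$ are polynomials with integer coefficients in $y$ and $a_{2,1},a_{3,1},a_{3,2},\dots,a_{n,n-1}$.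
   Context: $U$ is the group of lower triangular unipotent $n\times n$ matrices with entries in $\mathbb{Z}_p$, with below-diagonal entries $a=(a_{k,l})_{k>l}$. $Q_0$ is the group of upper triangular matrices in $GL_n(\mathbb{Z}_p)$ with diagonal entries in $1+p\mathbb{Z}_p$ and entries above the diagonal in $p\mathbb{Z}_p$. $E_{i,j}$ is the elementary matrix with $1$ in position $(i,j)$. -}

module Defs where

open import Data.Nat using (ℕ; zero; suc; _+_; _*_; _∸_; _^_; _<_; NonZero)
open import Data.Nat.Properties using (m^n≢0; *-assoc; m^n>0; m≤n⇒m∸n≡0)
open import Data.Nat.DivMod using (_%_; _/_; m%n<n; m≡m%n+[m/n]*n; [m+kn]%n≡m%n;
  %-distribˡ-+; %-distribˡ-*; %-pred-≡0; m*n%n≡0)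
open import Data.Integer as ℤ using (ℤ; +_; -[1+_])
open import Data.Fin as Fin using (Fin; _≟_)
import Data.Fin as F
open import Data.Product using (_×_)
open import Relation.Nullary using (yes; no)
open import Relation.Nullary.Decidable using (⌊_⌋)
open import Relation.Binary.PropositionalEquality
  using (_≡_; refl; sym; trans; cong; module ≡-Reasoning)
open import Data.Nat.Properties using (m∸n≤m)
open import Relation.Binary.PropositionalEquality using (cong₂)
open import Data.Nat using (s≤s)

%-%-* : ∀ m a b .{{_ : NonZero b}} .{{_ : NonZero (a * b)}} →
        m % (a * b) % b ≡ m % b
%-%-* m a b = sym (begin
    m % b
  ≡⟨ cong (_% b) (m≡m%n+[m/n]*n m (a * b)) ⟩
    (m % (a * b) + (m / (a * b)) * (a * b)) % b
  ≡⟨ cong (λ t → (m % (a * b) + t) % b) (sym (*-assoc (m / (a * b)) a b)) ⟩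
    (m % (a * b) + (m / (a * b) * a) * b) % b
  ≡⟨ [m+kn]%n≡m%n (m % (a * b)) (m / (a * b) * a) b ⟩
    m % (a * b) % b ∎)
  where open ≡-Reasoning

-- The p-adic integers ℤ_p, realised as the inverse limit of the rings
-- ℤ/p^k ℤ : an element is a compatible sequence of residues
-- (digit k ∈ {0,…,p^k - 1}) with digit (k+1) ≡ digit k (mod p^k).

nz : ∀ p k .{{_ : NonZero p}} → NonZero (p ^ k)
nz p k = m^n≢0 p k

record ℤₚ (p : ℕ) .{{_ : NonZero p}} : Set where
  constructor mkℤₚ
  field
    digit  : ℕ → ℕ
    bound  : ∀ k → digit k < p ^ k
    compat : ∀ k → _%_ (digit (suc k)) (p ^ k) {{nz p k}} ≡ digit k
open ℤₚ public

module _ {p : ℕ} .{{_ : NonZero p}} where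

  infixl 6 _+ₚ_ _-ₚ_
  infixl 7 _*ₚ_
  infix 4 _≈ₚ_
  infixl 7 _mod_

  _mod_ : ℕ → ℕ → ℕ
  m mod k = _%_ m (p ^ k) {{nz p k}}

  private
    mod< : ∀ m k → m mod k < p ^ k
    mod< m k = m%n<n m (p ^ k) {{nz p k}}
    modmod : ∀ m k → m mod (suc k) mod k ≡ m mod k
    modmod m k = %-%-* m p (p ^ k) {{nz p k}} {{nz p (suc k)}}

  _≈ₚ_ : ℤₚ p → ℤₚ p → Set
  x ≈ₚ y = ∀ k → digit x k ≡ digit y k

  fromℕₚ : ℕ → ℤₚ p
  fromℕₚ m = mkℤₚ (λ k → m mod k) (mod< m) (modmod m)

  0ₚ 1ₚ : ℤₚ p
  0ₚ = fromℕₚ 0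
  1ₚ = fromℕₚ 1

  _+ₚ_ : ℤₚ p → ℤₚ p → ℤₚ p
  x +ₚ y = mkℤₚ (λ k → (digit x k + digit y k) mod k)
    (λ k → mod< _ k)
    (λ k → let a = digit x (suc k) ; b = digit y (suc k) in
      trans (modmod (a + b) k)
        (trans (%-distribˡ-+ a b (p ^ k) {{nz p k}})
          (cong₂ (λ u v → (u + v) mod k) (compat x k) (compat y k))))

  _*ₚ_ : ℤₚ p → ℤₚ p → ℤₚ p
  x *ₚ y = mkℤₚ (λ k → (digit x k * digit y k) mod k)
    (λ k → mod< _ k)
    (λ k → let a = digit x (suc k) ; b = digit y (suc k) in
      trans (modmod (a * b) k)
        (trans (%-distribˡ-* a b (p ^ k) {{nz p k}})
          (cong₂ (λ u v → (u * v) mod k) (compat x k) (compat y k))))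

  -1ₚ : ℤₚ p
  -1ₚ = mkℤₚ (λ k → p ^ k ∸ 1) (λ k → h (p ^ k) (m^n>0 p k))
             (λ k → %-pred-≡0 {{nz p k}} (lem k))
    where
    h : ∀ m → 0 < m → m ∸ 1 < m
    h (suc t) _ = s≤s (m∸n≤m t 0)
    sp : ∀ m → 0 < m → suc (m ∸ 1) ≡ m
    sp (suc m) _ = refl
    lem : ∀ k → suc (p ^ suc k ∸ 1) mod k ≡ 0
    lem k = trans (cong (_mod k) (sp (p ^ suc k) (m^n>0 p (suc k))))
                  (m*n%n≡0 p (p ^ k) {{nz p k}})

  negₚ : ℤₚ p → ℤₚ p
  negₚ x = -1ₚ *ₚ x

  _-ₚ_ : ℤₚ p → ℤₚ p → ℤₚ p
  x -ₚ y = x +ₚ negₚ y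

  fromℤₚ : ℤ → ℤₚ p
  fromℤₚ (+ m)     = fromℕₚ m
  fromℤₚ -[1+ m ] = negₚ (fromℕₚ (suc m))

  _∈pℤₚ : ℤₚ p → Set
  x ∈pℤₚ = digit x 1 ≡ 0

-- n × n matrices over ℤ_p (indices 0,…,n-1 stand for the paper's 1,…,n)

Mat : (p : ℕ) .{{_ : NonZero p}} → ℕ → Set
Mat p n = Fin n → Fin n → ℤₚ p

module _ {p : ℕ} .{{_ : NonZero p}} where

  infix 4 _≈ₘ_
  infixl 7 _*ₘ_

  ∑ : ∀ {n} → (Fin n → ℤₚ p) → ℤₚ p
  ∑ {zero}  f = 0ₚ
  ∑ {suc n} f = f Fin.zero +ₚ ∑ (λ t → f (Fin.suc t))

  _≈ₘ_ : ∀ {n} → Mat p n → Mat p n → Set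
  M ≈ₘ N = ∀ r s → M r s ≈ₚ N r s

  _*ₘ_ : ∀ {n} → Mat p n → Mat p n → Mat p n
  (M *ₘ N) r s = ∑ (λ t → M r t *ₚ N t s)

  δ : ∀ {n} → Fin n → Fin n → ℤₚ p
  δ r s with r ≟ s
  ... | yes _ = 1ₚ
  ... | no  _ = 0ₚ

  Iₘ : ∀ {n} → Mat p n
  Iₘ r s = δ r s

  E : ∀ {n} → Fin n → Fin n → Mat p n
  E i j r s = δ r i *ₚ δ s j

  1-yE : ∀ {n} → ℤₚ p → Fin n → Fin n → Mat p n
  1-yE y i j r s = Iₘ r s -ₚ y *ₚ E i j r s

  InU : ∀ {n} → Mat p n → Set
  InU A = (∀ k → A k k ≈ₚ 1ₚ) × (∀ k l → k F.< l → A k l ≈ₚ 0ₚ)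

  -- Q₀ : upper triangular matrices in GL_n(ℤ_p) with diagonal entries in
  -- 1 + pℤ_p and entries above the diagonal in pℤ_p.  (Such a matrix is
  -- automatically invertible over ℤ_p, its diagonal entries being units.)
  InQ₀ : ∀ {n} → Mat p n → Set
  InQ₀ Z = (∀ r s → s F.< r → Z r s ≈ₚ 0ₚ)
         × (∀ r → (Z r r -ₚ 1ₚ) ∈pℤₚ)
         × (∀ r s → r F.< s → Z r s ∈pℤₚ)

-- Polynomials with integer coefficients (as formal expressions) in the
-- variables y and a_{k,l} (k > l), and their evaluation in ℤ_p.

data Var (n : ℕ) : Set where
  vy : Var n
  va : (k l : Fin n) → l F.< k → Var n

data Poly (V : Set) : Set where
  con  : ℤ → Poly V
  var  : V → Poly V
  _⊕_  : Poly V → Poly V → Poly V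
  _⊗_  : Poly V → Poly V → Poly V

module _ {p : ℕ} .{{_ : NonZero p}} where

  ⟦_⟧ : ∀ {V : Set} → Poly V → (V → ℤₚ p) → ℤₚ p
  ⟦ con c ⟧ ρ = fromℤₚ c
  ⟦ var v ⟧ ρ = ρ v
  ⟦ P ⊕ Q ⟧ ρ = ⟦ P ⟧ ρ +ₚ ⟦ Q ⟧ ρ
  ⟦ P ⊗ Q ⟧ ρ = ⟦ P ⟧ ρ *ₚ ⟦ Q ⟧ ρ

  env : ∀ {n} → ℤₚ p → Mat p n → Var n → ℤₚ p
  env y A vy         = y
  env y A (va k l _) = A k l

-- The proof is Gaussian elimination, carried out symbolically alongside.
-- A "shape" records numerator polynomials for all entries of a matrix over a
-- common denominator 1 - y·den.  If M has a shape, its pivot M₀₀ lies in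
-- 1 + pℤ_p and is a unit (1 - t is invertible for t ∈ pℤ_p), the rest of its
-- first row lies in pℤ_p, and the Schur complement of the pivot again has a
-- shape, computed from the first one.  Induction on the size then yields the
-- unique factorisation together with its numerators and denominators.
module Submission where

open import Defs
open import Data.Nat using (ℕ; NonZero)
open import Data.Nat.Primality using (Prime)
open import Data.Fin using (Fin; _<_)
open import Data.Product using (Σ; _×_; _,_)
open import Algebra.Bundles using (CommutativeRing)

module IntegerRingSolver {c ℓ} (R : CommutativeRing c ℓ) where

  open import Data.Nat as ℕ using (zero; suc)
  open import Data.Integer as ℤ using (ℤ; +_; -[1+_]; _⊖_)
  import Data.Nat.Properties as ℕProps
  import Data.Integer.Properties as ℤProps
  open import Data.Sign as Sign using (Sign)
  open import Data.Maybe using (Maybe; just; nothing)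
  open import Relation.Nullary using (yes; no)
  import Relation.Binary.PropositionalEquality as ≡
  open import Algebra.Solver.Ring.AlmostCommutativeRing
    using (fromCommutativeRing; _-Raw-AlmostCommutative⟶_)

  open CommutativeRing R
  open import Algebra.Properties.Ring ring using (-0#≈0#; -‿involutive; -‿distribˡ-*; -‿+-comm; -1*x≈-x)
  open import Algebra.Properties.Semiring.Mult.TCOptimised semiring
    using (1+×; ×-homo-+; ×1-homo-*) renaming (_×_ to _×ᴿ_)
  open import Relation.Binary.Reasoning.Setoid setoid

  fromℕ : ℕ → Carrier
  fromℕ n = n ×ᴿ 1#

  fromℤ : ℤ → Carrier
  fromℤ (+ n)     = fromℕ n
  fromℤ -[1+ n ] = - fromℕ (suc n)

  fromℤ-⊖ : ∀ m n → fromℤ (m ⊖ n) ≈ fromℕ m - fromℕ n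
  fromℤ-⊖ m       zero    = sym (trans (+-congˡ -0#≈0#) (+-identityʳ _))
  fromℤ-⊖ zero    (suc n) = sym (+-identityˡ _)
  fromℤ-⊖ (suc m) (suc n) = begin
    fromℤ (suc m ⊖ suc n)         ≡⟨ ≡.cong fromℤ (ℤProps.[1+m]⊖[1+n]≡m⊖n m n) ⟩
    fromℤ (m ⊖ n)                 ≈⟨ fromℤ-⊖ m n ⟩
    fromℕ m - fromℕ n             ≈⟨ +-congʳ (sym (+-identityˡ _)) ⟩
    (0# + fromℕ m) - fromℕ n      ≈⟨ +-congʳ (+-congʳ (sym (-‿inverseʳ 1#))) ⟩
    ((1# - 1#) + fromℕ m) - fromℕ n ≈⟨ +-congʳ (+-assoc 1# (- 1#) _) ⟩
    (1# + (- 1# + fromℕ m)) - fromℕ n ≈⟨ +-congʳ (+-congˡ (+-comm _ _)) ⟩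
    (1# + (fromℕ m - 1#)) - fromℕ n ≈⟨ +-congʳ (sym (+-assoc 1# _ (- 1#))) ⟩
    ((1# + fromℕ m) - 1#) - fromℕ n ≈⟨ +-assoc _ (- 1#) _ ⟩
    (1# + fromℕ m) + (- 1# - fromℕ n) ≈⟨ +-congˡ (-‿+-comm 1# _) ⟩
    (1# + fromℕ m) - (1# + fromℕ n) ≈⟨ +-cong (sym (1+× m 1#)) (-‿cong (sym (1+× n 1#))) ⟩
    fromℕ (suc m) - fromℕ (suc n) ∎

  fromℤ-+ : ∀ i j → fromℤ (i ℤ.+ j) ≈ fromℤ i + fromℤ j
  fromℤ-+ -[1+ m ] -[1+ n ] = begin
    - fromℕ (suc (suc (m ℕ.+ n)))      ≡⟨ ≡.cong (λ k → - fromℕ k) (≡.sym (ℕProps.+-suc (suc m) n)) ⟩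
    - fromℕ (suc m ℕ.+ suc n)          ≈⟨ -‿cong (×-homo-+ 1# (suc m) (suc n)) ⟩
    - (fromℕ (suc m) + fromℕ (suc n))  ≈⟨ sym (-‿+-comm _ _) ⟩
    - fromℕ (suc m) - fromℕ (suc n)    ∎
  fromℤ-+ -[1+ m ] (+ n)    = trans (fromℤ-⊖ n (suc m)) (+-comm _ _)
  fromℤ-+ (+ m)    -[1+ n ] = fromℤ-⊖ m (suc n)
  fromℤ-+ (+ m)    (+ n)    = ×-homo-+ 1# m n

  fromℤ-neg : ∀ i → fromℤ (ℤ.- i) ≈ - fromℤ i
  fromℤ-neg -[1+ n ]    = sym (-‿involutive _)
  fromℤ-neg (+ zero)    = sym -0#≈0#
  fromℤ-neg (+ (suc n)) = refl

  -- Multiplication: ℤ multiplies signs and absolute values separately.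
  fromSign : Sign → Carrier
  fromSign Sign.+ = 1#
  fromSign Sign.- = - 1#

  -1*-1≈1 : - 1# * - 1# ≈ 1#
  -1*-1≈1 = trans (sym (-‿distribˡ-* 1# (- 1#)))
                  (trans (-‿cong (*-identityˡ _)) (-‿involutive 1#))

  fromSign-* : ∀ s t → fromSign (s Sign.* t) ≈ fromSign s * fromSign t
  fromSign-* Sign.- Sign.- = sym -1*-1≈1
  fromSign-* Sign.- Sign.+ = sym (*-identityʳ _)
  fromSign-* Sign.+ t      = sym (*-identityˡ _)

  fromℤ-◃ : ∀ s n → fromℤ (s ℤ.◃ n) ≈ fromSign s * fromℕ n
  fromℤ-◃ s      zero    = sym (zeroʳ _)
  fromℤ-◃ Sign.- (suc n) = sym (-1*x≈-x _)
  fromℤ-◃ Sign.+ (suc n) = sym (*-identityˡ _)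

  fromℤ-signAbs : ∀ i → fromℤ i ≈ fromSign (ℤ.sign i) * fromℕ ℤ.∣ i ∣
  fromℤ-signAbs (+ n)     = sym (*-identityˡ _)
  fromℤ-signAbs -[1+ n ] = sym (-1*x≈-x _)

  fromℤ-* : ∀ i j → fromℤ (i ℤ.* j) ≈ fromℤ i * fromℤ j
  fromℤ-* i j = begin
    fromℤ (i ℤ.* j)                       ≈⟨ fromℤ-◃ (s Sign.* t) (a ℕ.* b) ⟩
    fromSign (s Sign.* t) * fromℕ (a ℕ.* b) ≈⟨ *-cong (fromSign-* s t) (×1-homo-* a b) ⟩
    (fromSign s * fromSign t) * (fromℕ a * fromℕ b) ≈⟨ interchange ⟩
    (fromSign s * fromℕ a) * (fromSign t * fromℕ b) ≈⟨ *-cong (sym (fromℤ-signAbs i)) (sym (fromℤ-signAbs j)) ⟩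
    fromℤ i * fromℤ j                     ∎
    where
    s t : Sign
    s = ℤ.sign i
    t = ℤ.sign j
    a b : ℕ
    a = ℤ.∣ i ∣
    b = ℤ.∣ j ∣
    interchange : (fromSign s * fromSign t) * (fromℕ a * fromℕ b)
                ≈ (fromSign s * fromℕ a) * (fromSign t * fromℕ b)
    interchange = begin
      (fromSign s * fromSign t) * (fromℕ a * fromℕ b) ≈⟨ *-assoc _ _ _ ⟩
      fromSign s * (fromSign t * (fromℕ a * fromℕ b)) ≈⟨ *-congˡ (sym (*-assoc _ _ _)) ⟩
      fromSign s * ((fromSign t * fromℕ a) * fromℕ b) ≈⟨ *-congˡ (*-congʳ (*-comm _ _)) ⟩
      fromSign s * ((fromℕ a * fromSign t) * fromℕ b) ≈⟨ *-congˡ (*-assoc _ _ _) ⟩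
      fromSign s * (fromℕ a * (fromSign t * fromℕ b)) ≈⟨ sym (*-assoc _ _ _) ⟩
      (fromSign s * fromℕ a) * (fromSign t * fromℕ b) ∎

  homomorphism : ℤ.+-*-rawRing -Raw-AlmostCommutative⟶ fromCommutativeRing R
  homomorphism = record
    { ⟦_⟧ = fromℤ ; +-homo = fromℤ-+ ; *-homo = fromℤ-* ; -‿homo = fromℤ-neg
    ; 0-homo = refl ; 1-homo = refl }

  -- equal integer coefficients have equal images (all the solver needs)
  coefficient≟ : ∀ i j → Maybe (fromℤ i ≈ fromℤ j)
  coefficient≟ i j with i ℤProps.≟ j
  ... | yes ≡.refl = just refl
  ... | no _       = nothing

  open import Algebra.Solver.Ring ℤ.+-*-rawRing (fromCommutativeRing R) homomorphism coefficient≟ public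

module Residues where

  open import Data.Nat as ℕ using (zero; suc; _%_; _^_)
  import Data.Nat.Properties as ℕProps
  open import Data.Nat.DivMod using (%-distribˡ-+; %-distribˡ-*; m%n%n≡m%n)
  open import Data.Nat.Divisibility as ∣ using (_∣_)
  open import Relation.Binary.PropositionalEquality as ≡ using (_≡_; cong)

  %-absorbˡ-+ : ∀ a b d .{{_ : NonZero d}} → (a % d ℕ.+ b) % d ≡ (a ℕ.+ b) % d
  %-absorbˡ-+ a b d = ≡.trans (%-distribˡ-+ (a % d) b d)
    (≡.trans (cong (λ t → (t ℕ.+ b % d) % d) (m%n%n≡m%n a d)) (≡.sym (%-distribˡ-+ a b d)))

  %-absorbʳ-+ : ∀ a b d .{{_ : NonZero d}} → (a ℕ.+ b % d) % d ≡ (a ℕ.+ b) % d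
  %-absorbʳ-+ a b d = ≡.trans (cong (_% d) (ℕProps.+-comm a (b % d)))
    (≡.trans (%-absorbˡ-+ b a d) (cong (_% d) (ℕProps.+-comm b a)))

  %-absorbˡ-* : ∀ a b d .{{_ : NonZero d}} → (a % d ℕ.* b) % d ≡ (a ℕ.* b) % d
  %-absorbˡ-* a b d = ≡.trans (%-distribˡ-* (a % d) b d)
    (≡.trans (cong (λ t → (t ℕ.* (b % d)) % d) (m%n%n≡m%n a d)) (≡.sym (%-distribˡ-* a b d)))

  %-absorbʳ-* : ∀ a b d .{{_ : NonZero d}} → (a ℕ.* (b % d)) % d ≡ (a ℕ.* b) % d
  %-absorbʳ-* a b d = ≡.trans (cong (_% d) (ℕProps.*-comm a (b % d)))
    (≡.trans (%-absorbˡ-* b a d) (cong (_% d) (ℕProps.*-comm b a)))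

  ^-pres-∣ : ∀ {a b} → a ∣ b → ∀ m → a ^ m ∣ b ^ m
  ^-pres-∣ a∣b zero    = ∣.∣-refl
  ^-pres-∣ a∣b (suc m) = ∣.*-pres-∣ a∣b (^-pres-∣ a∣b m)

module PAdicRing {p : ℕ} .{{_ : NonZero p}} where

  open import Data.Nat as ℕ using (_^_)
  import Data.Nat.Properties as ℕProps
  open import Data.Nat.DivMod using (m<n⇒m%n≡m; m*n%n≡0)
  open import Relation.Binary.PropositionalEquality as ≡ using (_≡_; cong; cong₂)
  open import Relation.Binary.Structures using (IsEquivalence)
  open import Relation.Binary.Bundles using (Setoid)
  open import Algebra.Structures using (IsCommutativeRing)
  import Relation.Binary.Reasoning.Setoid
  open Residues

  -- Residue-wise equality, wrapped in a record so that both sides can be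
  -- recovered from a proof by unification.
  infix 4 _≋_
  record _≋_ (x y : ℤₚ p) : Set where
    constructor ⟨_⟩
    field residues : x ≈ₚ y
  open _≋_ public

  private
    digit-reduced : ∀ (x : ℤₚ p) k → digit x k mod k ≡ digit x k
    digit-reduced x k = m<n⇒m%n≡m {{nz p k}} (bound x k)

  ≋-isEquivalence : IsEquivalence _≋_
  ≋-isEquivalence = record
    { refl  = ⟨ (λ k → ≡.refl) ⟩
    ; sym   = λ e → ⟨ (λ k → ≡.sym (residues e k)) ⟩
    ; trans = λ e f → ⟨ (λ k → ≡.trans (residues e k) (residues f k)) ⟩ }

  ≋-setoid : Setoid _ _
  ≋-setoid = record { isEquivalence = ≋-isEquivalence }

  +ₚ-cong : ∀ {x x′ y y′} → x ≋ x′ → y ≋ y′ → x +ₚ y ≋ x′ +ₚ y′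
  +ₚ-cong e f = ⟨ (λ k → cong₂ (λ a b → (a ℕ.+ b) mod k) (residues e k) (residues f k)) ⟩

  *ₚ-cong : ∀ {x x′ y y′} → x ≋ x′ → y ≋ y′ → x *ₚ y ≋ x′ *ₚ y′
  *ₚ-cong e f = ⟨ (λ k → cong₂ (λ a b → (a ℕ.* b) mod k) (residues e k) (residues f k)) ⟩

  negₚ-cong : ∀ {x x′} → x ≋ x′ → negₚ x ≋ negₚ x′
  negₚ-cong e = ⟨ (λ k → cong (λ b → ((p ^ k ℕ.∸ 1) ℕ.* b) mod k) (residues e k)) ⟩

  +ₚ-assoc : ∀ x y z → (x +ₚ y) +ₚ z ≋ x +ₚ (y +ₚ z)
  +ₚ-assoc x y z = ⟨ (λ k → ≡.trans (%-absorbˡ-+ (digit x k ℕ.+ digit y k) (digit z k) (p ^ k) {{nz p k}})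
    (≡.trans (cong (_mod k) (ℕProps.+-assoc (digit x k) (digit y k) (digit z k)))
      (≡.sym (%-absorbʳ-+ (digit x k) (digit y k ℕ.+ digit z k) (p ^ k) {{nz p k}})))) ⟩

  *ₚ-assoc : ∀ x y z → (x *ₚ y) *ₚ z ≋ x *ₚ (y *ₚ z)
  *ₚ-assoc x y z = ⟨ (λ k → ≡.trans (%-absorbˡ-* (digit x k ℕ.* digit y k) (digit z k) (p ^ k) {{nz p k}})
    (≡.trans (cong (_mod k) (ℕProps.*-assoc (digit x k) (digit y k) (digit z k)))
      (≡.sym (%-absorbʳ-* (digit x k) (digit y k ℕ.* digit z k) (p ^ k) {{nz p k}})))) ⟩

  +ₚ-comm : ∀ x y → x +ₚ y ≋ y +ₚ x
  +ₚ-comm x y = ⟨ (λ k → cong (_mod k) (ℕProps.+-comm (digit x k) (digit y k))) ⟩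

  *ₚ-comm : ∀ x y → x *ₚ y ≋ y *ₚ x
  *ₚ-comm x y = ⟨ (λ k → cong (_mod k) (ℕProps.*-comm (digit x k) (digit y k))) ⟩

  +ₚ-identityˡ : ∀ x → 0ₚ +ₚ x ≋ x
  +ₚ-identityˡ x = ⟨ (λ k → ≡.trans (%-absorbˡ-+ 0 (digit x k) (p ^ k) {{nz p k}}) (digit-reduced x k)) ⟩

  *ₚ-identityˡ : ∀ x → 1ₚ *ₚ x ≋ x
  *ₚ-identityˡ x = ⟨ (λ k → ≡.trans (%-absorbˡ-* 1 (digit x k) (p ^ k) {{nz p k}})
    (≡.trans (cong (_mod k) (ℕProps.*-identityˡ (digit x k))) (digit-reduced x k))) ⟩

  *ₚ-distribˡ-+ₚ : ∀ x y z → x *ₚ (y +ₚ z) ≋ x *ₚ y +ₚ x *ₚ z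
  *ₚ-distribˡ-+ₚ x y z = ⟨ (λ k → ≡.trans (%-absorbʳ-* (digit x k) (digit y k ℕ.+ digit z k) (p ^ k) {{nz p k}})
    (≡.trans (cong (_mod k) (ℕProps.*-distribˡ-+ (digit x k) (digit y k) (digit z k)))
      (≡.sym (≡.trans (%-absorbˡ-+ (digit x k ℕ.* digit y k) _ (p ^ k) {{nz p k}})
                      (%-absorbʳ-+ (digit x k ℕ.* digit y k) (digit x k ℕ.* digit z k) (p ^ k) {{nz p k}}))))) ⟩

  -- -x + x = ((p^k - 1)·x + x) mod p^k = (p^k · x) mod p^k = 0
  negₚ-inverseˡ : ∀ x → negₚ x +ₚ x ≋ 0ₚ
  negₚ-inverseˡ x = ⟨ (λ k → ≡.trans (%-absorbˡ-+ ((p ^ k ℕ.∸ 1) ℕ.* digit x k) (digit x k) (p ^ k) {{nz p k}})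
    (≡.trans (cong (_mod k) (multiple k))
      (≡.trans (m*n%n≡0 (digit x k) (p ^ k) {{nz p k}})
        (≡.sym (m<n⇒m%n≡m {{nz p k}} (ℕProps.m^n>0 p k)))))) ⟩
    where
    multiple : ∀ k → (p ^ k ℕ.∸ 1) ℕ.* digit x k ℕ.+ digit x k ≡ digit x k ℕ.* p ^ k
    multiple k = ≡.trans (ℕProps.+-comm ((p ^ k ℕ.∸ 1) ℕ.* digit x k) (digit x k))
      (≡.trans (cong (ℕ._* digit x k) (ℕProps.m+[n∸m]≡n {1} {p ^ k} (ℕProps.m^n>0 p k)))
               (ℕProps.*-comm (p ^ k) (digit x k)))

  isCommutativeRing : IsCommutativeRing _≋_ _+ₚ_ _*ₚ_ negₚ 0ₚ 1ₚ
  isCommutativeRing = record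
    { isRing = record
      { +-isAbelianGroup = record
        { isGroup = record
          { isMonoid = record
            { isSemigroup = record
              { isMagma = record { isEquivalence = ≋-isEquivalence ; ∙-cong = +ₚ-cong }
              ; assoc = +ₚ-assoc }
            ; identity = comm∧idˡ⇒id {_∙_ = _+ₚ_} +ₚ-comm {e = 0ₚ} +ₚ-identityˡ }
          ; inverse = comm∧invˡ⇒inv {_⁻¹ = negₚ} {e = 0ₚ} +ₚ-comm negₚ-inverseˡ
          ; ⁻¹-cong = negₚ-cong }
        ; comm = +ₚ-comm }
      ; *-cong = *ₚ-cong
      ; *-assoc = *ₚ-assoc
      ; *-identity = comm∧idˡ⇒id {_∙_ = _*ₚ_} *ₚ-comm {e = 1ₚ} *ₚ-identityˡ
      ; distrib = comm∧distrˡ⇒distr +ₚ-cong *ₚ-comm *ₚ-distribˡ-+ₚ }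
    ; *-comm = *ₚ-comm }
    where open import Algebra.Consequences.Setoid ≋-setoid

  commutativeRing : CommutativeRing _ _
  commutativeRing = record { isCommutativeRing = isCommutativeRing }

  open IntegerRingSolver commutativeRing public using (solve; _:=_; _:+_; _:*_; _:-_; con)
  open CommutativeRing commutativeRing public
    using (sym; trans; +-cong; *-cong; -‿cong) renaming (refl to ≋-refl)
  module ≋-Reasoning = Relation.Binary.Reasoning.Setoid ≋-setoid

module PAdicUnits {p : ℕ} .{{_ : NonZero p}} where

  open import Data.Nat as ℕ using (zero; suc; _^_)
  import Data.Nat.Properties as ℕProps
  open import Data.Nat.DivMod using (m<n⇒m%n≡m; m%n%n≡m%n; m∣n⇒o%n%m≡o%m; n%1≡0)
  open import Data.Nat.Divisibility as ∣ using (_∣_)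
  open import Data.Integer using (+_)
  open import Relation.Binary.PropositionalEquality as ≡ using (_≡_; cong; cong₂)

  open Residues using (%-absorbʳ-*; ^-pres-∣)
  open PAdicRing {p}
  open ≋-Reasoning

  ∈pℤₚ-resp : ∀ {x y} → x ≋ y → x ∈pℤₚ → y ∈pℤₚ
  ∈pℤₚ-resp e x∈ = ≡.trans (≡.sym (residues e 1)) x∈

  0-mod-p^k : ∀ k → 0 mod k ≡ 0
  0-mod-p^k k = m<n⇒m%n≡m {{nz p k}} (ℕProps.m^n>0 p k)

  ∈pℤₚ-*ʳ : ∀ x z → x ∈pℤₚ → (x *ₚ z) ∈pℤₚ
  ∈pℤₚ-*ʳ x z x∈ = ≡.trans (cong (λ a → (a ℕ.* digit z 1) mod 1) x∈) (0-mod-p^k 1)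

  ∈pℤₚ-*ˡ : ∀ z x → x ∈pℤₚ → (z *ₚ x) ∈pℤₚ
  ∈pℤₚ-*ˡ z x x∈ = ≡.trans (cong (λ a → (digit z 1 ℕ.* a) mod 1) x∈)
    (≡.trans (cong (_mod 1) (ℕProps.*-zeroʳ (digit z 1))) (0-mod-p^k 1))

  ∈pℤₚ-+ : ∀ x y → x ∈pℤₚ → y ∈pℤₚ → (x +ₚ y) ∈pℤₚ
  ∈pℤₚ-+ x y x∈ y∈ = ≡.trans (cong₂ (λ a b → (a ℕ.+ b) mod 1) x∈ y∈) (0-mod-p^k 1)

  -- x ∈ pℤ_p as soon as x (1 - t) ∈ pℤ_p for some t ∈ pℤ_p, as x = x (1 - t) + x t
  ∈pℤₚ-cancel : ∀ x t → t ∈pℤₚ → (x *ₚ (1ₚ -ₚ t)) ∈pℤₚ → x ∈pℤₚ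
  ∈pℤₚ-cancel x t t∈ x[1-t]∈ = ∈pℤₚ-resp
    (solve 2 (λ x t → x :* (con (+ 1) :- t) :+ x :* t := x) ⟨ (λ _ → ≡.refl) ⟩ x t)
    (∈pℤₚ-+ (x *ₚ (1ₚ -ₚ t)) (x *ₚ t) x[1-t]∈ (∈pℤₚ-*ˡ x t t∈))

  digit-mod-p : ∀ (x : ℤₚ p) k → digit x (suc k) mod 1 ≡ digit x 1
  digit-mod-p x zero    = m<n⇒m%n≡m {{nz p 1}} (bound x 1)
  digit-mod-p x (suc k) = ≡.trans
    (≡.sym (m∣n⇒o%n%m≡o%m (p ^ 1) (p ^ suc k) (digit x (suc (suc k))) {{nz p 1}} {{nz p (suc k)}} p∣p^[1+k]))
    (≡.trans (cong (_mod 1) (compat x (suc k))) (digit-mod-p x k))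
    where
    p∣p^[1+k] : p ^ 1 ∣ p ^ suc k
    p∣p^[1+k] = ∣.∣-trans (∣.∣-reflexive (ℕProps.*-identityʳ p)) (∣.m∣m*n (p ^ k))

  _^ₚ_ : ℤₚ p → ℕ → ℤₚ p
  t ^ₚ zero  = 1ₚ
  t ^ₚ suc m = t *ₚ t ^ₚ m

  digit-^ₚ : ∀ t m k → digit (t ^ₚ m) k ≡ (digit t k ^ m) mod k
  digit-^ₚ t zero    k = ≡.refl
  digit-^ₚ t (suc m) k = ≡.trans (cong (λ a → (digit t k ℕ.* a) mod k) (digit-^ₚ t m k))
    (%-absorbʳ-* (digit t k) (digit t k ^ m) (p ^ k) {{nz p k}})

  ^ₚ-vanishes : ∀ t → t ∈pℤₚ → ∀ k → digit (t ^ₚ k) k ≡ 0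
  ^ₚ-vanishes t t∈ zero    = n%1≡0 1
  ^ₚ-vanishes t t∈ (suc k) = ≡.trans (digit-^ₚ t (suc k) (suc k))
    (∣.n∣m⇒m%n≡0 _ _ {{nz p (suc k)}} (^-pres-∣ p∣t (suc k)))
    where
    p∣t : p ∣ digit t (suc k)
    p∣t = ≡.subst (_∣ digit t (suc k)) (ℕProps.*-identityʳ p)
            (∣.m%n≡0⇒n∣m _ _ {{nz p 1}} (≡.trans (digit-mod-p t k) t∈))

  geometric : ℤₚ p → ℕ → ℤₚ p
  geometric t zero    = 0ₚ
  geometric t (suc m) = geometric t m +ₚ t ^ₚ m

  geometric-telescopes : ∀ t m → (1ₚ -ₚ t) *ₚ geometric t m ≋ 1ₚ -ₚ t ^ₚ m
  geometric-telescopes t zero = solve 1 (λ t → (con (+ 1) :- t) :* con (+ 0) := con (+ 1) :- con (+ 1))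
    ⟨ (λ _ → ≡.refl) ⟩ t
  geometric-telescopes t (suc m) = begin
    (1ₚ -ₚ t) *ₚ (G +ₚ q)         ≈⟨ solve 3 (λ t G q → (con (+ 1) :- t) :* (G :+ q)
                                                := (con (+ 1) :- t) :* G :+ (q :- t :* q)) ⟨ (λ _ → ≡.refl) ⟩ t G q ⟩
    (1ₚ -ₚ t) *ₚ G +ₚ (q -ₚ t *ₚ q) ≈⟨ +-cong (geometric-telescopes t m) (≋-refl {q -ₚ t *ₚ q}) ⟩
    (1ₚ -ₚ q) +ₚ (q -ₚ t *ₚ q)     ≈⟨ solve 2 (λ t q → (con (+ 1) :- q) :+ (q :- t :* q) := con (+ 1) :- t :* q)
                                         ⟨ (λ _ → ≡.refl) ⟩ t q ⟩
    1ₚ -ₚ t *ₚ q                   ∎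
    where
    G q : ℤₚ p
    G = geometric t m
    q = t ^ₚ m

  -- 1 - t is a unit for t ∈ pℤ_p: its inverse is the p-adic limit of the
  -- geometric sums, whose k-th residue is that of the k-th partial sum.
  1-t-invertible : ∀ t → t ∈pℤₚ → Σ (ℤₚ p) λ w → (1ₚ -ₚ t) *ₚ w ≋ 1ₚ
  1-t-invertible t t∈ = w , ⟨ inverse ⟩
    where
    -- the partial sums stabilise modulo p^k from the k-th one on
    stable : ∀ k → digit (geometric t (suc k)) (suc k) mod k ≡ digit (geometric t k) k
    stable k = ≡.trans (compat (geometric t (suc k)) k)
      (≡.trans (cong (λ a → (digit (geometric t k) k ℕ.+ a) mod k) (^ₚ-vanishes t t∈ k))
        (≡.trans (cong (_mod k) (ℕProps.+-identityʳ _))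
                 (m<n⇒m%n≡m {{nz p k}} (bound (geometric t k) k))))
    w : ℤₚ p
    w = mkℤₚ (λ k → digit (geometric t k) k) (λ k → bound (geometric t k) k) stable
    inverse : ∀ k → digit ((1ₚ -ₚ t) *ₚ w) k ≡ digit 1ₚ k
    inverse k = ≡.trans (residues (geometric-telescopes t k) k)
      (≡.trans (cong (λ a → (1 mod k ℕ.+ ((p ^ k ℕ.∸ 1) ℕ.* a) mod k) mod k) (^ₚ-vanishes t t∈ k))
        (≡.trans (cong (λ a → (1 mod k ℕ.+ a mod k) mod k) (ℕProps.*-zeroʳ (p ^ k ℕ.∸ 1)))
          (≡.trans (cong (λ a → (1 mod k ℕ.+ a) mod k) (0-mod-p^k k))
            (≡.trans (cong (_mod k) (ℕProps.+-identityʳ _)) (m%n%n≡m%n 1 (p ^ k) {{nz p k}})))))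

module Matrices {p : ℕ} .{{_ : NonZero p}} where

  open import Data.Nat using (zero; suc; s≤s; z≤n)
  open import Data.Fin as Fin using (zero; suc)
  open import Data.Integer using (+_)
  open import Data.Empty using (⊥-elim)
  open import Relation.Nullary using (yes; no)
  open import Relation.Binary.PropositionalEquality as ≡ using (_≡_)

  open PAdicRing {p}
  open ≋-Reasoning

  ∑-cong : ∀ {n} {f g : Fin n → ℤₚ p} → (∀ t → f t ≋ g t) → ∑ f ≋ ∑ g
  ∑-cong {zero}  e = ≋-refl
  ∑-cong {suc n} e = +-cong (e zero) (∑-cong (λ t → e (suc t)))

  ∑-zero : ∀ {n} (f : Fin n → ℤₚ p) → (∀ t → f t ≋ 0ₚ) → ∑ f ≋ 0ₚ
  ∑-zero {zero}  f e = ≋-refl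
  ∑-zero {suc n} f e = trans (+-cong (e zero) (∑-zero (λ t → f (suc t)) (λ t → e (suc t))))
    (solve 0 (con (+ 0) :+ con (+ 0) := con (+ 0)) ⟨ (λ _ → ≡.refl) ⟩)

  ∑-+ : ∀ {n} (f g : Fin n → ℤₚ p) → ∑ (λ t → f t +ₚ g t) ≋ ∑ f +ₚ ∑ g
  ∑-+ {zero}  f g = solve 0 (con (+ 0) := con (+ 0) :+ con (+ 0)) ⟨ (λ _ → ≡.refl) ⟩
  ∑-+ {suc n} f g = trans (+-cong (≋-refl {f zero +ₚ g zero}) (∑-+ (λ t → f (suc t)) (λ t → g (suc t))))
    (solve 4 (λ a b c d → (a :+ b) :+ (c :+ d) := (a :+ c) :+ (b :+ d)) ⟨ (λ _ → ≡.refl) ⟩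
       (f zero) (g zero) (∑ (λ t → f (suc t))) (∑ (λ t → g (suc t))))

  ∑-*ˡ : ∀ {n} c (f : Fin n → ℤₚ p) → ∑ (λ t → c *ₚ f t) ≋ c *ₚ ∑ f
  ∑-*ˡ {zero}  c f = solve 1 (λ c → con (+ 0) := c :* con (+ 0)) ⟨ (λ _ → ≡.refl) ⟩ c
  ∑-*ˡ {suc n} c f = trans (+-cong (≋-refl {c *ₚ f zero}) (∑-*ˡ c (λ t → f (suc t))))
    (solve 3 (λ c a b → c :* a :+ c :* b := c :* (a :+ b)) ⟨ (λ _ → ≡.refl) ⟩ c (f zero) (∑ (λ t → f (suc t))))

  δ-suc : ∀ {n} (r t : Fin n) → δ {p} (suc r) (suc t) ≡ δ r t
  δ-suc r t with r Fin.≟ t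
  ... | yes _ = ≡.refl
  ... | no  _ = ≡.refl

  δ-sym : ∀ {n} (r t : Fin n) → δ {p} r t ≡ δ t r
  δ-sym r t with r Fin.≟ t | t Fin.≟ r
  ... | yes _   | yes _   = ≡.refl
  ... | no  _   | no  _   = ≡.refl
  ... | yes r≡t | no  t≢r = ⊥-elim (t≢r (≡.sym r≡t))
  ... | no  r≢t | yes t≡r = ⊥-elim (r≢t (≡.sym t≡r))

  ∑-δ : ∀ {n} (r : Fin n) (f : Fin n → ℤₚ p) → ∑ (λ t → δ r t *ₚ f t) ≋ f r
  ∑-δ {suc n} zero f = trans
    (+-cong (≋-refl {1ₚ *ₚ f zero})
            (∑-zero _ (λ t → solve 1 (λ a → con (+ 0) :* a := con (+ 0)) ⟨ (λ _ → ≡.refl) ⟩ (f (suc t)))))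
    (solve 1 (λ a → con (+ 1) :* a :+ con (+ 0) := a) ⟨ (λ _ → ≡.refl) ⟩ (f zero))
  ∑-δ {suc n} (suc r) f = trans
    (+-cong (solve 1 (λ a → con (+ 0) :* a := con (+ 0)) ⟨ (λ _ → ≡.refl) ⟩ (f zero))
            (trans (∑-cong (λ t → ≡.subst (λ e → δ (suc r) (suc t) *ₚ f (suc t) ≋ e *ₚ f (suc t))
                                          (δ-suc r t) ≋-refl))
                   (∑-δ r (λ t → f (suc t)))))
    (solve 1 (λ a → con (+ 0) :+ a := a) ⟨ (λ _ → ≡.refl) ⟩ (f (suc r)))

  ∑-δᵀ : ∀ {n} (r : Fin n) (f : Fin n → ℤₚ p) → ∑ (λ t → δ t r *ₚ f t) ≋ f r
  ∑-δᵀ r f = trans (∑-cong (λ t → ≡.subst (λ e → δ t r *ₚ f t ≋ e *ₚ f t) (δ-sym t r) ≋-refl)) (∑-δ r f)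

  minor : ∀ {n} → Mat p (suc n) → Mat p n
  minor M r s = M (suc r) (suc s)

  block : ∀ {n} → ℤₚ p → (Fin n → ℤₚ p) → (Fin n → ℤₚ p) → Mat p n → Mat p (suc n)
  block a row col B zero    zero    = a
  block a row col B zero    (suc s) = row s
  block a row col B (suc r) zero    = col r
  block a row col B (suc r) (suc s) = B r s

  InU-minor : ∀ {n} (X : Mat p (suc n)) → InU X → InU (minor X)
  InU-minor X (diag , upper) = (λ k → diag (suc k)) , (λ k l k<l → upper (suc k) (suc l) (s≤s k<l))

  InQ₀-minor : ∀ {n} (Z : Mat p (suc n)) → InQ₀ Z → InQ₀ (minor Z)
  InQ₀-minor Z (lower , diag , upper) =
    (λ r s s<r → lower (suc r) (suc s) (s≤s s<r)) , (λ r → diag (suc r)) ,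
    (λ r s r<s → upper (suc r) (suc s) (s≤s r<s))

  InU-block : ∀ {n} col {B : Mat p n} → InU B → InU (block 1ₚ (λ _ → 0ₚ) col B)
  InU-block col (diag , upper) = diag′ , upper′
    where
    diag′ : ∀ k → block 1ₚ (λ _ → 0ₚ) col _ k k ≈ₚ 1ₚ
    diag′ zero    = λ _ → ≡.refl
    diag′ (suc k) = diag k
    upper′ : ∀ k l → k < l → block 1ₚ (λ _ → 0ₚ) col _ k l ≈ₚ 0ₚ
    upper′ zero    (suc l) _         = λ _ → ≡.refl
    upper′ (suc k) (suc l) (s≤s k<l) = upper k l k<l

  InQ₀-block : ∀ {n} a row {B : Mat p n} → (a -ₚ 1ₚ) ∈pℤₚ → (∀ s → row s ∈pℤₚ) → InQ₀ B →
               InQ₀ (block a row (λ _ → 0ₚ) B)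
  InQ₀-block a row a∈ row∈ (lower , diag , upper) = lower′ , diag′ , upper′
    where
    lower′ : ∀ r s → s < r → block a row (λ _ → 0ₚ) _ r s ≈ₚ 0ₚ
    lower′ (suc r) zero    _         = λ _ → ≡.refl
    lower′ (suc r) (suc s) (s≤s s<r) = lower r s s<r
    diag′ : ∀ r → (block a row (λ _ → 0ₚ) _ r r -ₚ 1ₚ) ∈pℤₚ
    diag′ zero    = a∈
    diag′ (suc r) = diag r
    upper′ : ∀ r s → r < s → block a row (λ _ → 0ₚ) _ r s ∈pℤₚ
    upper′ zero    (suc s) _         = row∈ s
    upper′ (suc r) (suc s) (s≤s r<s) = upper r s r<s

  -- Block multiplication: when X is unipotent lower triangular the first row
  -- of X Z is that of Z, and when the first column of Z vanishes below Z₀₀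
  -- the first column of X Z is that of X times Z₀₀.  (The minor of X Z is,
  -- by definition of the sum, X_{r0} Z_{0s} plus the product of the minors.)
  *ₘ-firstRow : ∀ {n} (X Z : Mat p (suc n)) → InU X → ∀ s → (X *ₘ Z) zero s ≋ Z zero s
  *ₘ-firstRow X Z (diag , upper) s = begin
    X zero zero *ₚ Z zero s +ₚ ∑ (λ t → X zero (suc t) *ₚ Z (suc t) s)
      ≈⟨ +-cong (*-cong X₀₀≋1 (≋-refl {Z zero s})) (∑-zero _ vanishes) ⟩
    1ₚ *ₚ Z zero s +ₚ 0ₚ
      ≈⟨ solve 1 (λ a → con (+ 1) :* a :+ con (+ 0) := a) ⟨ (λ _ → ≡.refl) ⟩ (Z zero s) ⟩
    Z zero s ∎
    where
    X₀₀≋1 : X zero zero ≋ 1ₚ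
    X₀₀≋1 = ⟨ diag zero ⟩
    vanishes : ∀ t → X zero (suc t) *ₚ Z (suc t) s ≋ 0ₚ
    vanishes t = begin
      X zero (suc t) *ₚ Z (suc t) s ≈⟨ *-cong X₀ₜ≋0 (≋-refl {Z (suc t) s}) ⟩
      0ₚ *ₚ Z (suc t) s             ≈⟨ solve 1 (λ a → con (+ 0) :* a := con (+ 0)) ⟨ (λ _ → ≡.refl) ⟩ (Z (suc t) s) ⟩
      0ₚ                            ∎
      where
      X₀ₜ≋0 : X zero (suc t) ≋ 0ₚ
      X₀ₜ≋0 = ⟨ upper zero (suc t) (s≤s z≤n) ⟩

  *ₘ-firstColumn : ∀ {n} (X Z : Mat p (suc n)) →
                   (∀ t → Z (suc t) zero ≈ₚ 0ₚ) → ∀ r →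
                   (X *ₘ Z) (suc r) zero ≋ X (suc r) zero *ₚ Z zero zero
  *ₘ-firstColumn X Z column r = begin
    X (suc r) zero *ₚ Z zero zero +ₚ ∑ (λ t → X (suc r) (suc t) *ₚ Z (suc t) zero)
      ≈⟨ +-cong (≋-refl {X (suc r) zero *ₚ Z zero zero}) (∑-zero _ vanishes) ⟩
    X (suc r) zero *ₚ Z zero zero +ₚ 0ₚ
      ≈⟨ solve 1 (λ a → a :+ con (+ 0) := a) ⟨ (λ _ → ≡.refl) ⟩ (X (suc r) zero *ₚ Z zero zero) ⟩
    X (suc r) zero *ₚ Z zero zero ∎
    where
    vanishes : ∀ t → X (suc r) (suc t) *ₚ Z (suc t) zero ≋ 0ₚ
    vanishes t = begin
      X (suc r) (suc t) *ₚ Z (suc t) zero ≈⟨ *-cong (≋-refl {X (suc r) (suc t)}) Zₜ₀≋0 ⟩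
      X (suc r) (suc t) *ₚ 0ₚ ≈⟨ solve 1 (λ a → a :* con (+ 0) := con (+ 0)) ⟨ (λ _ → ≡.refl) ⟩ (X (suc r) (suc t)) ⟩
      0ₚ ∎
      where
      Zₜ₀≋0 : Z (suc t) zero ≋ 0ₚ
      Zₜ₀≋0 = ⟨ column t ⟩

  ≈ₘ-block : ∀ {n} (X : Mat p (suc n)) a row col B → X zero zero ≈ₚ a → (∀ s → X zero (suc s) ≈ₚ row s) →
             (∀ r → X (suc r) zero ≈ₚ col r) → minor X ≈ₘ B → X ≈ₘ block a row col B
  ≈ₘ-block X a row col B corner first-row first-col minors zero    zero    = corner
  ≈ₘ-block X a row col B corner first-row first-col minors zero    (suc s) = first-row s
  ≈ₘ-block X a row col B corner first-row first-col minors (suc r) zero    = first-col r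
  ≈ₘ-block X a row col B corner first-row first-col minors (suc r) (suc s) = minors r s

module Factorisation {p : ℕ} .{{_ : NonZero p}} where

  open import Data.Nat using (zero; suc; s≤s; z≤n)
  open import Data.Fin using (zero; suc)
  open import Data.Integer using (+_)
  open import Data.Product using (proj₁; proj₂)
  import Relation.Binary.PropositionalEquality as ≡

  open PAdicRing {p}
  open Matrices {p}
  open ≋-Reasoning

  record UniqueUQ₀ {n} (M : Mat p n) : Set where
    field
      X Z      : Mat p n
      X∈U      : InU X
      Z∈Q₀     : InQ₀ Z
      M≈XZ     : M ≈ₘ X *ₘ Z
      unique   : ∀ X′ Z′ → InU X′ → InQ₀ Z′ → M ≈ₘ X′ *ₘ Z′ → (X′ ≈ₘ X) × (Z′ ≈ₘ Z)

  UniqueUQ₀-empty : (M : Mat p 0) → UniqueUQ₀ M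
  UniqueUQ₀-empty M = record
    { X = λ () ; Z = λ () ; X∈U = (λ ()) , (λ ()) ; Z∈Q₀ = (λ ()) , (λ ()) , (λ ())
    ; M≈XZ = λ () ; unique = λ _ _ _ _ _ → (λ ()) , (λ ()) }

  module Elimination {n} (M : Mat p (suc n)) (w : ℤₚ p) (pivot⁻¹ : M zero zero *ₚ w ≋ 1ₚ) where

    multiplier : Fin n → ℤₚ p
    multiplier r = M (suc r) zero *ₚ w

    schur : Mat p n
    schur r s = M (suc r) (suc s) -ₚ multiplier r *ₚ M zero (suc s)

    multiplier-pivot : ∀ r → multiplier r *ₚ M zero zero ≋ M (suc r) zero
    multiplier-pivot r = begin
      (M (suc r) zero *ₚ w) *ₚ M zero zero ≈⟨ solve 3 (λ a w m → (a :* w) :* m := a :* (m :* w))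
                                                 ⟨ (λ _ → ≡.refl) ⟩ (M (suc r) zero) w (M zero zero) ⟩
      M (suc r) zero *ₚ (M zero zero *ₚ w) ≈⟨ *-cong (≋-refl {M (suc r) zero}) pivot⁻¹ ⟩
      M (suc r) zero *ₚ 1ₚ                 ≈⟨ solve 1 (λ a → a :* con (+ 1) := a) ⟨ (λ _ → ≡.refl) ⟩ (M (suc r) zero) ⟩
      M (suc r) zero                       ∎

    lowerFactor : Mat p n → Mat p (suc n)
    lowerFactor X = block 1ₚ (λ _ → 0ₚ) multiplier X

    upperFactor : Mat p n → Mat p (suc n)
    upperFactor Z = block (M zero zero) (λ s → M zero (suc s)) (λ _ → 0ₚ) Z

    lift-factorisation : (X Z : Mat p n) → InU X → schur ≈ₘ X *ₘ Z →
                         M ≈ₘ lowerFactor X *ₘ upperFactor Z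
    lift-factorisation X Z X∈U S≈XZ = λ r s → residues (entry r s)
      where
      schur≋XZ : ∀ r s → schur r s ≋ (X *ₘ Z) r s
      schur≋XZ r s = ⟨ S≈XZ r s ⟩
      X̂∈U : InU (lowerFactor X)
      X̂∈U = InU-block multiplier X∈U
      entry : ∀ r s → M r s ≋ (lowerFactor X *ₘ upperFactor Z) r s
      entry zero    zero    = sym (*ₘ-firstRow (lowerFactor X) (upperFactor Z) X̂∈U zero)
      entry zero    (suc s) = sym (*ₘ-firstRow (lowerFactor X) (upperFactor Z) X̂∈U (suc s))
      entry (suc r) zero    = sym (trans (*ₘ-firstColumn (lowerFactor X) (upperFactor Z) (λ _ _ → ≡.refl) r) (multiplier-pivot r))
      entry (suc r) (suc s) = begin
        M (suc r) (suc s)                    ≈⟨ solve 2 (λ a b → a := b :+ (a :- b)) ⟨ (λ _ → ≡.refl) ⟩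
                                                   (M (suc r) (suc s)) (multiplier r *ₚ M zero (suc s)) ⟩
        multiplier r *ₚ M zero (suc s) +ₚ schur r s ≈⟨ +-cong (≋-refl {multiplier r *ₚ M zero (suc s)}) (schur≋XZ r s) ⟩
        multiplier r *ₚ M zero (suc s) +ₚ (X *ₘ Z) r s ∎

    restrict-factorisation : (X′ Z′ : Mat p (suc n)) → InU X′ → InQ₀ Z′ → M ≈ₘ X′ *ₘ Z′ →
      (∀ s → Z′ zero s ≋ M zero s) × (∀ r → X′ (suc r) zero ≋ multiplier r) ×
      (schur ≈ₘ minor X′ *ₘ minor Z′)
    restrict-factorisation X′ Z′ X′∈U Z′∈Q₀ M≈X′Z′ = first-row , first-column , λ r s → residues (minors r s)
      where
      M≋X′Z′ : ∀ r s → M r s ≋ (X′ *ₘ Z′) r s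
      M≋X′Z′ r s = ⟨ M≈X′Z′ r s ⟩
      first-row : ∀ s → Z′ zero s ≋ M zero s
      first-row s = sym (trans (M≋X′Z′ zero s) (*ₘ-firstRow X′ Z′ X′∈U s))
      first-column : ∀ r → X′ (suc r) zero ≋ multiplier r
      first-column r = begin
        X′ (suc r) zero                            ≈⟨ solve 1 (λ x → x := x :* con (+ 1)) ⟨ (λ _ → ≡.refl) ⟩ (X′ (suc r) zero) ⟩
        X′ (suc r) zero *ₚ 1ₚ                      ≈⟨ *-cong (≋-refl {X′ (suc r) zero}) (sym pivot⁻¹) ⟩
        X′ (suc r) zero *ₚ (M zero zero *ₚ w)       ≈⟨ *-cong (≋-refl {X′ (suc r) zero}) (*-cong (sym (first-row zero)) (≋-refl {w})) ⟩
        X′ (suc r) zero *ₚ (Z′ zero zero *ₚ w)      ≈⟨ solve 3 (λ x z w → x :* (z :* w) := (x :* z) :* w)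
                                                        ⟨ (λ _ → ≡.refl) ⟩ (X′ (suc r) zero) (Z′ zero zero) w ⟩
        (X′ (suc r) zero *ₚ Z′ zero zero) *ₚ w      ≈⟨ *-cong (sym (trans (M≋X′Z′ (suc r) zero)
                                                          (*ₘ-firstColumn X′ Z′ (λ t → proj₁ Z′∈Q₀ (suc t) zero (s≤s z≤n)) r)))
                                                          (≋-refl {w}) ⟩
        M (suc r) zero *ₚ w                        ∎
      minors : ∀ r s → schur r s ≋ (minor X′ *ₘ minor Z′) r s
      minors r s = begin
        M (suc r) (suc s) -ₚ multiplier r *ₚ M zero (suc s)
          ≈⟨ +-cong (M≋X′Z′ (suc r) (suc s)) (-‿cong (*-cong (sym (first-column r)) (sym (first-row (suc s))))) ⟩
        (X′ (suc r) zero *ₚ Z′ zero (suc s) +ₚ (minor X′ *ₘ minor Z′) r s) -ₚ X′ (suc r) zero *ₚ Z′ zero (suc s)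
          ≈⟨ solve 2 (λ a b → (a :+ b) :- a := b) ⟨ (λ _ → ≡.refl) ⟩
               (X′ (suc r) zero *ₚ Z′ zero (suc s)) ((minor X′ *ₘ minor Z′) r s) ⟩
        (minor X′ *ₘ minor Z′) r s ∎

    extend : (M zero zero -ₚ 1ₚ) ∈pℤₚ → (∀ s → M zero (suc s) ∈pℤₚ) → UniqueUQ₀ schur → UniqueUQ₀ M
    extend pivot∈ row∈ F = record
      { X      = lowerFactor F.X
      ; Z      = upperFactor F.Z
      ; X∈U    = InU-block multiplier F.X∈U
      ; Z∈Q₀   = InQ₀-block (M zero zero) (λ s → M zero (suc s)) pivot∈ row∈ F.Z∈Q₀
      ; M≈XZ   = lift-factorisation F.X F.Z F.X∈U F.M≈XZ
      ; unique = unique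
      }
      where
      module F = UniqueUQ₀ F
      unique : ∀ X′ Z′ → InU X′ → InQ₀ Z′ → M ≈ₘ X′ *ₘ Z′ → (X′ ≈ₘ lowerFactor F.X) × (Z′ ≈ₘ upperFactor F.Z)
      unique X′ Z′ X′∈U Z′∈Q₀ M≈X′Z′ =
        let first-row , first-column , schur≈ = restrict-factorisation X′ Z′ X′∈U Z′∈Q₀ M≈X′Z′
            X-minors , Z-minors = F.unique (minor X′) (minor Z′) (InU-minor X′ X′∈U) (InQ₀-minor Z′ Z′∈Q₀) schur≈
        in ≈ₘ-block X′ 1ₚ (λ _ → 0ₚ) multiplier F.X (proj₁ X′∈U zero) (λ s → proj₂ X′∈U zero (suc s) (s≤s z≤n))
                    (λ r → residues (first-column r)) X-minors ,
           ≈ₘ-block Z′ (M zero zero) (λ s → M zero (suc s)) (λ _ → 0ₚ) F.Z (residues (first-row zero))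
                    (λ s → residues (first-row (suc s))) (λ r → proj₁ Z′∈Q₀ (suc r) zero (s≤s z≤n)) Z-minors

-- Shapes: symbolic descriptions of matrices all of whose entries are
-- fractions with a common denominator 1 - y·den, diagonal entries having
-- numerators 1 - y·diag r, entries above the diagonal y·upper r s and
-- entries below it lower r s, for polynomials over variables V.
module Shapes (V : Set) (y : Poly V) where

  open import Data.Nat using (zero; suc; s≤s; z≤n)
  open import Data.Fin using (zero; suc)
  open import Data.Integer using (+_; -[1+_])
  open import Data.Product using (proj₁; proj₂)
  import Relation.Binary.PropositionalEquality as ≡

  1ᴾ : Poly V
  1ᴾ = con (+ 1)

  _⊝_ : Poly V → Poly V → Poly V
  a ⊝ b = a ⊕ (con -[1+ 0 ] ⊗ b)

  record Shape (n : ℕ) : Set where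
    constructor shape
    field
      den   : Poly V
      diag  : Fin n → Poly V
      upper : Fin n → Fin n → Poly V
      lower : Fin n → Fin n → Poly V
  open Shape public

  -- the shape of the Schur complement of the first pivot: writing
  -- c = 1 - y·diag 0, the new denominator is (1 - y·den)·c
  schurShape : ∀ {n} → Shape (suc n) → Shape n
  schurShape S = shape
    ((den S ⊕ g₀) ⊝ ((y ⊗ den S) ⊗ g₀))
    (λ r → ((diag S (suc r) ⊕ g₀) ⊝ ((y ⊗ diag S (suc r)) ⊗ g₀)) ⊕ (lower S (suc r) zero ⊗ upper S zero (suc r)))
    (λ r s → (upper S (suc r) (suc s) ⊗ c) ⊝ (lower S (suc r) zero ⊗ upper S zero (suc s)))
    (λ r s → (lower S (suc r) (suc s) ⊗ c) ⊝ (lower S (suc r) zero ⊗ (y ⊗ upper S zero (suc s))))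
    where
    g₀ c : Poly V
    g₀ = diag S zero
    c  = 1ᴾ ⊝ (y ⊗ g₀)

  numerators denominators : ∀ {n} → Shape n → Fin n → Fin n → Poly V
  numerators S zero    zero    = diag S zero
  numerators S zero    (suc s) = upper S zero (suc s)
  numerators S (suc r) zero    = lower S (suc r) zero
  numerators S (suc r) (suc s) = numerators (schurShape S) r s
  denominators S zero    zero    = den S
  denominators S zero    (suc s) = den S
  denominators S (suc r) zero    = diag S zero
  denominators S (suc r) (suc s) = denominators (schurShape S) r s

  module Semantics {p : ℕ} .{{_ : NonZero p}} (ρ : V → ℤₚ p) (y∈ : ⟦ y ⟧ ρ ∈pℤₚ) where

    open PAdicRing {p}
    open PAdicUnits {p}
    open Matrices {p}
    open Factorisation {p}
    open ≋-Reasoning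

    ŷ : ℤₚ p
    ŷ = ⟦ y ⟧ ρ

    denominator : ∀ {n} → Shape n → ℤₚ p
    denominator S = 1ₚ -ₚ ŷ *ₚ ⟦ den S ⟧ ρ

    record Realises {n} (S : Shape n) (M : Mat p n) : Set where
      field
        diag≋  : ∀ r → M r r *ₚ denominator S ≋ 1ₚ -ₚ ŷ *ₚ ⟦ diag S r ⟧ ρ
        upper≋ : ∀ r s → r < s → M r s *ₚ denominator S ≋ ŷ *ₚ ⟦ upper S r s ⟧ ρ
        lower≋ : ∀ r s → s < r → M r s *ₚ denominator S ≋ ⟦ lower S r s ⟧ ρ

    HasForms : ∀ {n} (h g : Fin n → Fin n → Poly V) (X Z : Mat p n) → Set
    HasForms h g X Z =
        (∀ r → Z r r *ₚ (1ₚ -ₚ ŷ *ₚ ⟦ g r r ⟧ ρ) ≈ₚ 1ₚ -ₚ ŷ *ₚ ⟦ h r r ⟧ ρ)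
      × (∀ r s → r < s → Z r s *ₚ (1ₚ -ₚ ŷ *ₚ ⟦ g r s ⟧ ρ) ≈ₚ ŷ *ₚ ⟦ h r s ⟧ ρ)
      × (∀ k l → l < k → X k l *ₚ (1ₚ -ₚ ŷ *ₚ ⟦ g k l ⟧ ρ) ≈ₚ ⟦ h k l ⟧ ρ)

    -- The first pivot of a matrix M described by S, with D its denominator:
    -- M₀₀ D = c := 1 - y·g₀ is a unit, so M₀₀ has the inverse w = D c⁻¹.
    module Pivot {n} (S : Shape (suc n)) (M : Mat p (suc n)) (R : Realises S M) where

      open Realises R

      D g₀ c c⁻¹ w : ℤₚ p
      D   = denominator S
      g₀  = ⟦ diag S zero ⟧ ρ
      c   = 1ₚ -ₚ ŷ *ₚ g₀
      c⁻¹ = proj₁ (1-t-invertible (ŷ *ₚ g₀) (∈pℤₚ-*ʳ ŷ g₀ y∈))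
      w   = D *ₚ c⁻¹

      c·c⁻¹ : c *ₚ c⁻¹ ≋ 1ₚ
      c·c⁻¹ = proj₂ (1-t-invertible (ŷ *ₚ g₀) (∈pℤₚ-*ʳ ŷ g₀ y∈))

      pivot⁻¹ : M zero zero *ₚ w ≋ 1ₚ
      pivot⁻¹ = begin
        M zero zero *ₚ (D *ₚ c⁻¹) ≈⟨ solve 3 (λ m D i → m :* (D :* i) := (m :* D) :* i) ⟨ (λ _ → ≡.refl) ⟩ (M zero zero) D c⁻¹ ⟩
        (M zero zero *ₚ D) *ₚ c⁻¹ ≈⟨ *-cong (diag≋ zero) (≋-refl {c⁻¹}) ⟩
        c *ₚ c⁻¹                  ≈⟨ c·c⁻¹ ⟩
        1ₚ                        ∎

      w·c : w *ₚ c ≋ D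
      w·c = begin
        (D *ₚ c⁻¹) *ₚ c ≈⟨ solve 3 (λ D i c → (D :* i) :* c := D :* (c :* i)) ⟨ (λ _ → ≡.refl) ⟩ D c⁻¹ c ⟩
        D *ₚ (c *ₚ c⁻¹) ≈⟨ *-cong (≋-refl {D}) c·c⁻¹ ⟩
        D *ₚ 1ₚ         ≈⟨ solve 1 (λ D → D :* con (+ 1) := D) ⟨ (λ _ → ≡.refl) ⟩ D ⟩
        D               ∎

      yden∈ : (ŷ *ₚ ⟦ den S ⟧ ρ) ∈pℤₚ
      yden∈ = ∈pℤₚ-*ʳ ŷ (⟦ den S ⟧ ρ) y∈

      -- the pivot lies in 1 + pℤ_p: (M₀₀ - 1) D = c - D = y (den - g₀)
      pivot∈1+pℤₚ : (M zero zero -ₚ 1ₚ) ∈pℤₚ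
      pivot∈1+pℤₚ = ∈pℤₚ-cancel (M zero zero -ₚ 1ₚ) (ŷ *ₚ ⟦ den S ⟧ ρ) yden∈
        (∈pℤₚ-resp (sym numerator) (∈pℤₚ-*ʳ ŷ (⟦ den S ⟧ ρ -ₚ g₀) y∈))
        where
        numerator : (M zero zero -ₚ 1ₚ) *ₚ D ≋ ŷ *ₚ (⟦ den S ⟧ ρ -ₚ g₀)
        numerator = begin
          (M zero zero -ₚ 1ₚ) *ₚ D ≈⟨ solve 2 (λ m D → (m :- con (+ 1)) :* D := m :* D :- D)
                                        ⟨ (λ _ → ≡.refl) ⟩ (M zero zero) D ⟩
          M zero zero *ₚ D -ₚ D   ≈⟨ +-cong (diag≋ zero) (≋-refl {negₚ D}) ⟩
          c -ₚ D                 ≈⟨ solve 3 (λ y g d → (con (+ 1) :- y :* g) :- (con (+ 1) :- y :* d) := y :* (d :- g))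
                                        ⟨ (λ _ → ≡.refl) ⟩ ŷ g₀ (⟦ den S ⟧ ρ) ⟩
          ŷ *ₚ (⟦ den S ⟧ ρ -ₚ g₀) ∎

      -- the rest of the first row lies in pℤ_p, its numerators being multiples of y
      row∈pℤₚ : ∀ s → M zero (suc s) ∈pℤₚ
      row∈pℤₚ s = ∈pℤₚ-cancel (M zero (suc s)) (ŷ *ₚ ⟦ den S ⟧ ρ) yden∈
        (∈pℤₚ-resp (sym (upper≋ zero (suc s) (s≤s z≤n))) (∈pℤₚ-*ʳ ŷ (⟦ upper S zero (suc s) ⟧ ρ) y∈))

      open Elimination M w pivot⁻¹ public using (multiplier; schur)

      -- the multipliers have denominator c: M_{r0} w c = M_{r0} D
      multiplier-form : ∀ r → multiplier r *ₚ c ≋ ⟦ lower S (suc r) zero ⟧ ρ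
      multiplier-form r = begin
        (M (suc r) zero *ₚ w) *ₚ c ≈⟨ solve 3 (λ a w c → (a :* w) :* c := a :* (w :* c)) ⟨ (λ _ → ≡.refl) ⟩ (M (suc r) zero) w c ⟩
        M (suc r) zero *ₚ (w *ₚ c) ≈⟨ *-cong (≋-refl {M (suc r) zero}) w·c ⟩
        M (suc r) zero *ₚ D        ≈⟨ lower≋ (suc r) zero (s≤s z≤n) ⟩
        ⟦ lower S (suc r) zero ⟧ ρ ∎

      -- the Schur complement has denominator D c: its entries times D c are
      -- (M_{rs} D) c - (M_{r0} D)(M_{0s} D)
      schur-numerator : ∀ r s {a l u} → M (suc r) (suc s) *ₚ D ≋ a → M (suc r) zero *ₚ D ≋ l →
                        M zero (suc s) *ₚ D ≋ u → schur r s *ₚ denominator (schurShape S) ≋ a *ₚ c -ₚ l *ₚ u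
      schur-numerator r s {a} {l} {u} a≋ l≋ u≋ = begin
        (Mᵣₛ -ₚ (Mᵣ₀ *ₚ w) *ₚ M₀ₛ) *ₚ denominator (schurShape S)
          ≈⟨ *-cong (≋-refl {Mᵣₛ -ₚ (Mᵣ₀ *ₚ w) *ₚ M₀ₛ})
               (solve 3 (λ y d g → con (+ 1) :- y :* ((d :+ g) :+ con -[1+ 0 ] :* ((y :* d) :* g))
                                   := (con (+ 1) :- y :* d) :* (con (+ 1) :- y :* g))
                        ⟨ (λ _ → ≡.refl) ⟩ ŷ (⟦ den S ⟧ ρ) g₀) ⟩
        (Mᵣₛ -ₚ (Mᵣ₀ *ₚ w) *ₚ M₀ₛ) *ₚ (D *ₚ c)
          ≈⟨ solve 6 (λ a b e w D c → (a :- (b :* w) :* e) :* (D :* c) := (a :* D) :* c :- ((b :* D) :* e) :* (w :* c))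
               ⟨ (λ _ → ≡.refl) ⟩ Mᵣₛ Mᵣ₀ M₀ₛ w D c ⟩
        (Mᵣₛ *ₚ D) *ₚ c -ₚ ((Mᵣ₀ *ₚ D) *ₚ M₀ₛ) *ₚ (w *ₚ c)
          ≈⟨ +-cong (≋-refl {(Mᵣₛ *ₚ D) *ₚ c}) (-‿cong (*-cong (≋-refl {(Mᵣ₀ *ₚ D) *ₚ M₀ₛ}) w·c)) ⟩
        (Mᵣₛ *ₚ D) *ₚ c -ₚ ((Mᵣ₀ *ₚ D) *ₚ M₀ₛ) *ₚ D
          ≈⟨ solve 4 (λ x l e D → x :- (l :* e) :* D := x :- l :* (e :* D))
               ⟨ (λ _ → ≡.refl) ⟩ ((Mᵣₛ *ₚ D) *ₚ c) (Mᵣ₀ *ₚ D) M₀ₛ D ⟩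
        (Mᵣₛ *ₚ D) *ₚ c -ₚ (Mᵣ₀ *ₚ D) *ₚ (M₀ₛ *ₚ D)
          ≈⟨ +-cong (*-cong a≋ (≋-refl {c})) (-‿cong (*-cong l≋ u≋)) ⟩
        a *ₚ c -ₚ l *ₚ u ∎
        where
        Mᵣₛ Mᵣ₀ M₀ₛ : ℤₚ p
        Mᵣₛ = M (suc r) (suc s)
        Mᵣ₀ = M (suc r) zero
        M₀ₛ = M zero (suc s)

      schur-realises : Realises (schurShape S) schur
      schur-realises = record { diag≋ = diag′ ; upper≋ = upper′ ; lower≋ = lower′ }
        where
        first-column : ∀ r → M (suc r) zero *ₚ D ≋ ⟦ lower S (suc r) zero ⟧ ρ
        first-column r = lower≋ (suc r) zero (s≤s z≤n)
        first-row : ∀ s → M zero (suc s) *ₚ D ≋ ŷ *ₚ ⟦ upper S zero (suc s) ⟧ ρ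
        first-row s = upper≋ zero (suc s) (s≤s z≤n)

        diag′ : ∀ r → schur r r *ₚ denominator (schurShape S) ≋ 1ₚ -ₚ ŷ *ₚ ⟦ diag (schurShape S) r ⟧ ρ
        diag′ r = trans (schur-numerator r r (diag≋ (suc r)) (first-column r) (first-row r))
          (solve 5 (λ y G g L H → (con (+ 1) :- y :* G) :* (con (+ 1) :- y :* g) :- L :* (y :* H)
                      := con (+ 1) :- y :* (((G :+ g) :+ con -[1+ 0 ] :* ((y :* G) :* g)) :+ L :* H))
            ⟨ (λ _ → ≡.refl) ⟩ ŷ (⟦ diag S (suc r) ⟧ ρ) g₀ (⟦ lower S (suc r) zero ⟧ ρ) (⟦ upper S zero (suc r) ⟧ ρ))

        upper′ : ∀ r s → r < s → schur r s *ₚ denominator (schurShape S) ≋ ŷ *ₚ ⟦ upper (schurShape S) r s ⟧ ρ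
        upper′ r s r<s = trans (schur-numerator r s (upper≋ (suc r) (suc s) (s≤s r<s)) (first-column r) (first-row s))
          (solve 5 (λ y U g L H → (y :* U) :* (con (+ 1) :- y :* g) :- L :* (y :* H)
                      := y :* ((U :* (con (+ 1) :+ con -[1+ 0 ] :* (y :* g))) :+ con -[1+ 0 ] :* (L :* H)))
            ⟨ (λ _ → ≡.refl) ⟩ ŷ (⟦ upper S (suc r) (suc s) ⟧ ρ) g₀ (⟦ lower S (suc r) zero ⟧ ρ) (⟦ upper S zero (suc s) ⟧ ρ))

        lower′ : ∀ r s → s < r → schur r s *ₚ denominator (schurShape S) ≋ ⟦ lower (schurShape S) r s ⟧ ρ
        lower′ r s s<r = trans (schur-numerator r s (lower≋ (suc r) (suc s) (s≤s s<r)) (first-column r) (first-row s))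
          (solve 5 (λ y A g L H → A :* (con (+ 1) :- y :* g) :- L :* (y :* H)
                      := (A :* (con (+ 1) :+ con -[1+ 0 ] :* (y :* g))) :+ con -[1+ 0 ] :* (L :* (y :* H)))
            ⟨ (λ _ → ≡.refl) ⟩ ŷ (⟦ lower S (suc r) (suc s) ⟧ ρ) g₀ (⟦ lower S (suc r) zero ⟧ ρ) (⟦ upper S zero (suc s) ⟧ ρ))

    decompose : ∀ {n} (S : Shape n) (M : Mat p n) → Realises S M →
                Σ (UniqueUQ₀ M) λ F → HasForms (numerators S) (denominators S) (UniqueUQ₀.X F) (UniqueUQ₀.Z F)
    decompose {zero}  S M R = UniqueUQ₀-empty M , (λ ()) , (λ ()) , (λ ())
    decompose {suc n} S M R =
      let F , diag-forms , upper-forms , lower-forms = decompose (schurShape S) schur schur-realises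
      in  extend pivot∈1+pℤₚ row∈pℤₚ F
        , (λ { zero → residues (diag≋ zero) ; (suc r) → diag-forms r })
        , (λ { zero (suc s) 0<s → residues (upper≋ zero (suc s) 0<s)
             ; (suc r) (suc s) (s≤s r<s) → upper-forms r s r<s })
        , (λ { (suc k) zero _ → residues (multiplier-form k)
             ; (suc k) (suc l) (s≤s l<k) → lower-forms k l l<k })
      where
      open Realises R
      open Pivot S M R
      open Elimination M w pivot⁻¹ using (extend)

module ProductShape (n : ℕ) (i j : Fin n) where

  open import Data.Fin as Fin using ()
  open import Data.Fin.Properties using (<-cmp)
  open import Data.Integer using (+_; -[1+_])
  open import Data.Product using (proj₁; proj₂)
  open import Relation.Nullary using (yes; no)
  open import Relation.Binary.Definitions using (tri<; tri≈; tri>)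
  import Relation.Binary.PropositionalEquality as ≡

  open Shapes (Var n) (var vy)

  entryᴾ : Fin n → Fin n → Poly (Var n)
  entryᴾ k l with <-cmp k l
  ... | tri< _ _ _   = con (+ 0)
  ... | tri≈ _ _ _   = con (+ 1)
  ... | tri> _ _ l<k = var (va k l l<k)

  δᴾ : Fin n → Fin n → Poly (Var n)
  δᴾ r t with r Fin.≟ t
  ... | yes _ = con (+ 1)
  ... | no  _ = con (+ 0)

  productShape : Shape n
  productShape = shape (con (+ 0))
    (λ r → δᴾ r i ⊗ entryᴾ j r)
    (λ r s → con -[1+ 0 ] ⊗ (δᴾ r i ⊗ entryᴾ j s))
    (λ r s → entryᴾ r s ⊝ (var vy ⊗ (δᴾ r i ⊗ entryᴾ j s)))

  module _ {p : ℕ} .{{_ : NonZero p}} (y : ℤₚ p) (y∈ : y ∈pℤₚ) (A : Mat p n) (A∈U : InU A) where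

    open PAdicRing {p}
    open Matrices {p}
    open Semantics (env y A) y∈
    open ≋-Reasoning

    entryᴾ-eval : ∀ k l → ⟦ entryᴾ k l ⟧ (env y A) ≋ A k l
    entryᴾ-eval k l with <-cmp k l
    ... | tri< k<l _ _  = ⟨ (λ t → ≡.sym (proj₂ A∈U k l k<l t)) ⟩
    ... | tri≈ _ ≡.refl _ = ⟨ (λ t → ≡.sym (proj₁ A∈U k t)) ⟩
    ... | tri> _ _ _    = ⟨ (λ _ → ≡.refl) ⟩

    δᴾ-eval : ∀ r t → ⟦ δᴾ r t ⟧ (env y A) ≋ δ r t
    δᴾ-eval r t with r Fin.≟ t
    ... | yes _ = ⟨ (λ _ → ≡.refl) ⟩
    ... | no  _ = ⟨ (λ _ → ≡.refl) ⟩

    M : Mat p n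
    M = 1-yE y i j *ₘ A

    product-entry : ∀ r s → M r s ≋ A r s -ₚ y *ₚ (δ r i *ₚ A j s)
    product-entry r s = begin
      ∑ (λ t → (δ r t -ₚ y *ₚ (δ r i *ₚ δ t j)) *ₚ A t s)
        ≈⟨ ∑-cong (λ t → solve 5 (λ a y b d e → (a :- y :* (b :* d)) :* e := a :* e :+ (con -[1+ 0 ] :* (y :* b)) :* (d :* e))
                                   ⟨ (λ _ → ≡.refl) ⟩ (δ r t) y (δ r i) (δ t j) (A t s)) ⟩
      ∑ (λ t → δ r t *ₚ A t s +ₚ c *ₚ (δ t j *ₚ A t s))
        ≈⟨ ∑-+ (λ t → δ r t *ₚ A t s) (λ t → c *ₚ (δ t j *ₚ A t s)) ⟩
      ∑ (λ t → δ r t *ₚ A t s) +ₚ ∑ (λ t → c *ₚ (δ t j *ₚ A t s))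
        ≈⟨ +-cong (∑-δ r (λ t → A t s)) (∑-*ˡ c (λ t → δ t j *ₚ A t s)) ⟩
      A r s +ₚ c *ₚ ∑ (λ t → δ t j *ₚ A t s)
        ≈⟨ +-cong (≋-refl {A r s}) (*-cong (≋-refl {c}) (∑-δᵀ j (λ t → A t s))) ⟩
      A r s +ₚ c *ₚ A j s
        ≈⟨ solve 4 (λ a y b e → a :+ (con -[1+ 0 ] :* (y :* b)) :* e := a :- y :* (b :* e))
             ⟨ (λ _ → ≡.refl) ⟩ (A r s) y (δ r i) (A j s) ⟩
      A r s -ₚ y *ₚ (δ r i *ₚ A j s) ∎
      where
      c : ℤₚ p
      c = negₚ 1ₚ *ₚ (y *ₚ δ r i)

    numerator : ∀ r s → M r s *ₚ denominator productShape ≋ A r s -ₚ y *ₚ ⟦ δᴾ r i ⊗ entryᴾ j s ⟧ (env y A)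
    numerator r s = begin
      M r s *ₚ (1ₚ -ₚ y *ₚ 0ₚ)                   ≈⟨ *-cong (product-entry r s) (≋-refl {1ₚ -ₚ y *ₚ 0ₚ}) ⟩
      (A r s -ₚ y *ₚ (δ r i *ₚ A j s)) *ₚ (1ₚ -ₚ y *ₚ 0ₚ)
        ≈⟨ solve 3 (λ a y q → (a :- y :* q) :* (con (+ 1) :- y :* con (+ 0)) := a :- y :* q)
             ⟨ (λ _ → ≡.refl) ⟩ (A r s) y (δ r i *ₚ A j s) ⟩
      A r s -ₚ y *ₚ (δ r i *ₚ A j s)             ≈⟨ +-cong (≋-refl {A r s}) (-‿cong (*-cong (≋-refl {y})
                                                      (sym (*-cong (δᴾ-eval r i) (entryᴾ-eval j s))))) ⟩
      A r s -ₚ y *ₚ ⟦ δᴾ r i ⊗ entryᴾ j s ⟧ (env y A) ∎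

    product-realises : Realises productShape M
    product-realises = record
      { diag≋  = λ r → trans (numerator r r) (+-cong (diagonal r) (≋-refl {negₚ (y *ₚ q r r)}))
      ; upper≋ = λ r s r<s → trans (numerator r s)
          (trans (+-cong (above r s r<s) (≋-refl {negₚ (y *ₚ q r s)}))
                 (solve 2 (λ y q → con (+ 0) :- y :* q := y :* (con -[1+ 0 ] :* q)) ⟨ (λ _ → ≡.refl) ⟩ y (q r s)))
      ; lower≋ = λ r s _ → trans (numerator r s)
          (trans (+-cong (sym (entryᴾ-eval r s)) (≋-refl {negₚ (y *ₚ q r s)}))
                 (solve 3 (λ a y q → a :- y :* q := a :+ con -[1+ 0 ] :* (y :* q)) ⟨ (λ _ → ≡.refl) ⟩
                    (⟦ entryᴾ r s ⟧ (env y A)) y (q r s)))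
      }
      where
      q : Fin n → Fin n → ℤₚ p
      q r s = ⟦ δᴾ r i ⊗ entryᴾ j s ⟧ (env y A)
      diagonal : ∀ r → A r r ≋ 1ₚ
      diagonal r = ⟨ proj₁ A∈U r ⟩
      above : ∀ r s → r < s → A r s ≋ 0ₚ
      above r s r<s = ⟨ proj₂ A∈U r s r<s ⟩

-- The polynomials h, g are those produced by elimination on the product shape;
-- the factorisation and the forms of its entries come from 'decompose'.
lemma3p4 : (p : ℕ) .{{_ : NonZero p}} → Prime p → (n : ℕ) (i j : Fin n) → i < j →
    Σ (Fin n → Fin n → Poly (Var n)) λ h →
    Σ (Fin n → Fin n → Poly (Var n)) λ g →
    (y : ℤₚ p) → y ∈pℤₚ → (A : Mat p n) → InU A →
    Σ (Mat p n) λ X → Σ (Mat p n) λ Z →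
      (InU X × InQ₀ Z × (1-yE y i j *ₘ A ≈ₘ X *ₘ Z))
      × ((X′ Z′ : Mat p n) → InU X′ → InQ₀ Z′ → 1-yE y i j *ₘ A ≈ₘ X′ *ₘ Z′ →
           (X′ ≈ₘ X) × (Z′ ≈ₘ Z))
      × ((r : Fin n) →
           Z r r *ₚ (1ₚ -ₚ y *ₚ ⟦ g r r ⟧ (env y A))
             ≈ₚ 1ₚ -ₚ y *ₚ ⟦ h r r ⟧ (env y A))
      × ((r s : Fin n) → r < s →
           Z r s *ₚ (1ₚ -ₚ y *ₚ ⟦ g r s ⟧ (env y A))
             ≈ₚ y *ₚ ⟦ h r s ⟧ (env y A))
      × ((k l : Fin n) → l < k →
           X k l *ₚ (1ₚ -ₚ y *ₚ ⟦ g k l ⟧ (env y A))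
             ≈ₚ ⟦ h k l ⟧ (env y A))
lemma3p4 p _ n i j _ = numerators productShape , denominators productShape , λ y y∈ A A∈U →
  let open Semantics (env y A) y∈ using (decompose)
      F , forms = decompose productShape (1-yE y i j *ₘ A) (product-realises y y∈ A A∈U)
      open Factorisation.UniqueUQ₀ F
  in X , Z , (X∈U , Z∈Q₀ , M≈XZ) , unique , forms
  where
  open ProductShape n i j
  open Shapes (Var n) (var vy) using (numerators; denominators; module Semantics)
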